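{- Let $\ell > k \geq 3$ with $\ell \geq 6$, and let $n \geq \lfloor \frac{\ell-2}{2} \rfloor$. Then $$sat(K_k^n,C_{\ell}) \leq kn- \ell+1 + \left\lfloor \frac{\ell-2}{2} \right\rfloor ^2 + 2 \left( \ell-1-2 \left\lfloor \frac{\ell-2}{2} \right\rfloor \right) \left\lfloor \frac{\ell-2}{2} \right\rfloor,$$ that is, $sat(K_k^n,C_{\ell}) \le kn + \frac{\ell^2-2\ell-11}{4}$ if $\ell$ is odd and $sat(K_k^n,C_{\ell}) \le kn + \frac{\ell^2-4\ell}{4}$ if $\ell$ is even.
   Context: All graphs are finite, simple and undirected. $K_k^n$ denotes the complete $k$-partite graph with exactly $n$ vertices in each of its $k$ parts. $C_\ell$ denotes the cycle on $\ell$ vertices. For graphs $G$ and $F$, a spanning subgraph $H$ of $G$ is $F$-saturated relative to $G$ if $H$ contains no copy of $F$ but $H+e$ contains a copy of $F$ for every $e\in E(G)\setminus E(H)$; $sat(G,F)$ is the minimum number of edges of a graph that is $F$-saturated relative to $G$. -}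

module Defs where

open import Data.Nat using (ℕ; zero; suc; _+_; _*_; _∸_; _<ᵇ_; _≡ᵇ_)
open import Data.Fin using (Fin; toℕ)
open import Data.Bool using (Bool; true; false; _∨_; _∧_; if_then_else_; T)
open import Data.List using (List; map; allFin; cartesianProduct)
open import Data.Nat.ListAction using (sum)
open import Data.Product using (_×_; _,_; Σ; proj₁; proj₂)
open import Data.Sum using (_⊎_)
open import Relation.Binary.PropositionalEquality using (_≡_; _≢_)
open import Relation.Nullary using (¬_)
open import Function.Definitions using (Injective)

-- Vertices of K_k^n : (part , index within part)
V : ℕ → ℕ → Set
V k n = Fin k × Fin n

KAdj : ∀ {k n} → V k n → V k n → Set
KAdj u v = proj₁ u ≢ proj₁ v

Graph : ℕ → ℕ → Set
Graph k n = V k n → V k n → Bool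

-- H is a spanning subgraph of K_k^n (symmetric, edges only between parts;
-- hence also loopless)
IsSpanningSubgraph : ∀ {k n} → Graph k n → Set
IsSpanningSubgraph {k} {n} H =
  (∀ (u v : V k n) → H u v ≡ H v u) ×
  (∀ (u v : V k n) → T (H u v) → KAdj u v)

CycSucc : ∀ {ℓ} → Fin ℓ → Fin ℓ → Set
CycSucc {ℓ} i j = (toℕ j ≡ suc (toℕ i)) ⊎ ((toℕ i ≡ ℓ ∸ 1) × (toℕ j ≡ 0))

HasCycle : {W : Set} → (ℓ : ℕ) → (W → W → Set) → Set
HasCycle {W} ℓ R =
  Σ (Fin ℓ → W) λ f → Injective _≡_ _≡_ f × (∀ i j → CycSucc i j → R (f i) (f j))

AddEdge : ∀ {k n} → Graph k n → V k n → V k n → V k n → V k n → Set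
AddEdge H u v x y = T (H x y) ⊎ ((x ≡ u × y ≡ v) ⊎ (x ≡ v × y ≡ u))

IsCycleSaturated : ∀ {k n} → ℕ → Graph k n → Set
IsCycleSaturated {k} {n} ℓ H =
  IsSpanningSubgraph H ×
  (¬ HasCycle ℓ (λ x y → T (H x y))) ×
  (∀ (u v : V k n) → KAdj u v → H u v ≡ false → HasCycle ℓ (AddEdge H u v))

allV : ∀ k n → List (V k n)
allV k n = cartesianProduct (allFin k) (allFin n)

ltV : ∀ {k n} → V k n → V k n → Bool
ltV (p , i) (q , j) = (toℕ p <ᵇ toℕ q) ∨ ((toℕ p ≡ᵇ toℕ q) ∧ (toℕ i <ᵇ toℕ j))

-- number of edges: unordered pairs {u,v} (counted once via u < v) with H u v
numEdges : ∀ {k n} → Graph k n → ℕ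
numEdges {k} {n} H =
  sum (map (λ u → sum (map (λ v → if ltV u v ∧ H u v then 1 else 0) (allV k n))) (allV k n))

-- Write ℓ = 2m + r + 1 with m = ⌊(ℓ-2)/2⌋ ≥ 2 and r ∈ {1, 2}. On the first m, m and r vertices of the
-- parts 0, 1, 2 of K_k^n put a complete tripartite graph K_{m,m,r} (the core, N = ℓ - 1 vertices), and
-- hang every other vertex as a leaf on a core vertex outside its own part, the host of its part, chosen
-- injectively in the part (possible as k < ℓ). A leaf lies on no cycle, so every cycle stays in the core
-- and is shorter than ℓ. Adding a missing edge from a leaf u to a core vertex d closes an ℓ-cycle
-- through u and a Hamiltonian path of the core from the host of u to d; adding an edge between leaves u
-- and v closes one through a path between their (distinct) hosts that misses one core vertex.
-- K_{m,m,r} has both kinds of paths between any two vertices: a few explicit ones, moved around by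
-- part-preserving permutations. The graph has m² + 2mr core edges and one edge per leaf.
module Submission where

open import Data.Bool using (Bool; true; false; T; not; _∧_; _∨_; if_then_else_)
open import Data.Bool.Properties using (∨-comm; ∨-identityʳ; T-∨; T-∧)
open import Data.Empty using (⊥; ⊥-elim)
open import Data.Fin using (Fin; zero; suc; toℕ; fromℕ; fromℕ<; inject₁; inject≤; _↑ˡ_)
import Data.Fin.Properties as Finₚ
open Finₚ
  using (toℕ-fromℕ; toℕ-fromℕ<; toℕ-inject₁; toℕ<n; toℕ-injective; ↑ˡ-injective; <⇒notInjective; +↔⊎)
open import Data.List
  using (List; []; _∷_; _++_; _∷ʳ_; map; reverse; length; head; last; lookup; allFin; cartesianProduct)
open import Data.List.Properties
  using ( length-map; length-reverse; head-map; last-map; unfold-reverse; reverse-involutive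
        ; map-++; map-∘; map-cong; map-tabulate)
open import Data.List.Membership.Propositional.Properties using (∈-lookup)
open import Data.List.Relation.Unary.All as All using (All; []; _∷_)
open import Data.List.Relation.Unary.All.Properties as Allₚ using (¬Any⇒All¬; All¬⇒¬Any)
open import Data.List.Relation.Unary.Any.Properties using (reverse⁻)
open import Data.List.Relation.Unary.AllPairs using ([]; _∷_)
open import Data.List.Relation.Unary.Linked as Linked using (Linked; []; [-]; _∷_)
import Data.List.Relation.Unary.Linked.Properties as Linkedₚ
open import Data.List.Relation.Unary.Unique.Propositional using (Unique)
import Data.List.Relation.Unary.Unique.Propositional.Properties as Uniqueₚ
open import Data.List.Relation.Binary.Permutation.Propositional using (↭-sym; ↭⇒↭ₛ)
open import Data.List.Relation.Binary.Permutation.Propositional.Properties using (↭-reverse)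
import Data.List.Relation.Binary.Permutation.Setoid.Properties as Permutationₛ
open import Data.Maybe using (Maybe; just; nothing; is-just; is-nothing)
import Data.Maybe as Maybe
open import Data.Maybe.Properties using (just-injective)
open import Data.Maybe.Relation.Binary.Connected using (Connected; just)
open import Data.Nat using (ℕ; zero; suc; _+_; _*_; _∸_; _≤_; _<_; _<ᵇ_; _≡ᵇ_; z≤n; s≤s; _<?_; ⌊_/2⌋)
open import Data.Nat.ListAction using (sum)
open import Data.Nat.ListAction.Properties using (sum-++)
open import Data.Nat.Properties
open import Algebra.Properties.CommutativeSemigroup +-commutativeSemigroup using (interchange)
open import Data.Nat.Tactic.RingSolver using (solve-∀)
open import Data.Product using (Σ; _×_; _,_; proj₁; proj₂)
import Data.Product.Properties as Σₚ
open import Data.Sum using (_⊎_; inj₁; inj₂)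
import Data.Sum as Sum
import Data.Sum.Properties as Sumₚ
open import Data.Sum.Function.Propositional using (_⊎-↔_)
open import Data.Unit using (tt)
open import Function using (_∘_; mk⇔; Equivalence)
open import Function.Bundles using (Inverse; Injection; _↔_)
open import Function.Definitions using (Injective)
open import Function.Properties.Inverse using (↔-refl; ↔-trans; ↔-sym; ↔⇒↣)
open import Level using (0ℓ)
open import Relation.Binary using (Rel; Symmetric; DecidableEquality)
open import Relation.Binary.PropositionalEquality
open import Relation.Nullary using (¬_; yes; no)
open import Relation.Nullary.Decidable
  using (⌊_⌋; isYes≗does; dec-false; does-⇔; toWitness; fromWitness; toWitnessFalse; fromWitnessFalse)
open import Defs

-- Finite sums

χ : Bool → ℕ
χ b = if b then 1 else 0

χ≤1 : ∀ b → χ b ≤ 1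
χ≤1 true  = ≤-refl
χ≤1 false = z≤n

∑ : ∀ {A : Set} → List A → (A → ℕ) → ℕ
∑ xs f = sum (map f xs)

syntax ∑ xs (λ x → e) = ∑[ x ∈ xs ] e

module _ {A : Set} where

  ∑-cong : ∀ (xs : List A) {f g : A → ℕ} → (∀ x → f x ≡ g x) → ∑ xs f ≡ ∑ xs g
  ∑-cong xs f≗g = cong sum (map-cong f≗g xs)

  ∑-mono : ∀ (xs : List A) {f g : A → ℕ} → (∀ x → f x ≤ g x) → ∑ xs f ≤ ∑ xs g
  ∑-mono []       f≤g = z≤n
  ∑-mono (x ∷ xs) f≤g = +-mono-≤ (f≤g x) (∑-mono xs f≤g)

  ∑-vanishing : ∀ {xs : List A} {f : A → ℕ} → All (λ x → f x ≡ 0) xs → ∑ xs f ≡ 0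
  ∑-vanishing []           = refl
  ∑-vanishing (fx≡0 ∷ f≡0) = cong₂ _+_ fx≡0 (∑-vanishing f≡0)

  ∑-zero : ∀ (xs : List A) {f : A → ℕ} → (∀ x → f x ≡ 0) → ∑ xs f ≡ 0
  ∑-zero xs f≡0 = ∑-vanishing (All.universal f≡0 xs)

  ∑-distrib-+ : ∀ (xs : List A) (f g : A → ℕ) → ∑[ x ∈ xs ] (f x + g x) ≡ ∑ xs f + ∑ xs g
  ∑-distrib-+ []       f g = refl
  ∑-distrib-+ (x ∷ xs) f g = trans (cong (f x + g x +_) (∑-distrib-+ xs f g)) (interchange (f x) (g x) _ _)

  ∑-distribˡ-* : ∀ (xs : List A) c (f : A → ℕ) → ∑[ x ∈ xs ] (c * f x) ≡ c * ∑ xs f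
  ∑-distribˡ-* []       c f = sym (*-zeroʳ c)
  ∑-distribˡ-* (x ∷ xs) c f = trans (cong (c * f x +_) (∑-distribˡ-* xs c f)) (sym (*-distribˡ-+ c (f x) _))

  ∑-distribʳ-* : ∀ (xs : List A) c (f : A → ℕ) → ∑[ x ∈ xs ] (f x * c) ≡ ∑ xs f * c
  ∑-distribʳ-* xs c f = trans (∑-cong xs (λ x → *-comm (f x) c)) (trans (∑-distribˡ-* xs c f) (*-comm c _))

  ∑-delta : (_≟_ : DecidableEquality A) {xs : List A} → Unique xs → ∀ w → ∑[ x ∈ xs ] χ ⌊ x ≟ w ⌋ ≤ 1
  ∑-delta _≟_ {[]}     []            w = z≤n
  ∑-delta _≟_ {x ∷ xs} (x∉xs ∷ uniq) w with x ≟ w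
  ... | yes refl = ≤-reflexive (cong (1 +_) (∑-vanishing (All.map absent x∉xs)))
    where
    absent : ∀ {y} → x ≢ y → χ ⌊ y ≟ x ⌋ ≡ 0
    absent {y} x≢y = cong χ (trans (isYes≗does (y ≟ x)) (dec-false (y ≟ x) (x≢y ∘ sym)))
  ... | no _     = ∑-delta _≟_ uniq w

∑-map : ∀ {A B : Set} (g : A → B) (xs : List A) (f : B → ℕ) → ∑ (map g xs) f ≡ ∑ xs (f ∘ g)
∑-map g xs f = cong sum (sym (map-∘ xs))

module _ {A B : Set} where

  ∑-comm : ∀ (xs : List A) (ys : List B) (f : A → B → ℕ) →
           ∑[ x ∈ xs ] ∑[ y ∈ ys ] f x y ≡ ∑[ y ∈ ys ] ∑[ x ∈ xs ] f x y
  ∑-comm []       ys f = sym (∑-zero ys (λ _ → refl))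
  ∑-comm (x ∷ xs) ys f = trans (cong (∑ ys (f x) +_) (∑-comm xs ys f))
                               (sym (∑-distrib-+ ys (f x) (λ y → ∑[ x′ ∈ xs ] f x′ y)))

  ∑-cartesianProduct : ∀ (xs : List A) (ys : List B) (f : A × B → ℕ) →
                       ∑ (cartesianProduct xs ys) f ≡ ∑[ x ∈ xs ] ∑[ y ∈ ys ] f (x , y)
  ∑-cartesianProduct []       ys f = refl
  ∑-cartesianProduct (x ∷ xs) ys f = begin
    sum (map f (map (x ,_) ys ++ cartesianProduct xs ys))
      ≡⟨ cong sum (map-++ f (map (x ,_) ys) _) ⟩
    sum (map f (map (x ,_) ys) ++ map f (cartesianProduct xs ys))
      ≡⟨ sum-++ (map f (map (x ,_) ys)) _ ⟩
    ∑ (map (x ,_) ys) f + ∑ (cartesianProduct xs ys) f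
      ≡⟨ cong₂ _+_ (∑-map (x ,_) ys f) (∑-cartesianProduct xs ys f) ⟩
    ∑[ y ∈ ys ] f (x , y) + ∑[ x′ ∈ xs ] ∑[ y ∈ ys ] f (x′ , y)
      ∎
    where open ≡-Reasoning

χ-∧ : ∀ a b → χ (a ∧ b) ≡ χ a * χ b
χ-∧ true  b = sym (+-identityʳ (χ b))
χ-∧ false b = refl

χ-∧-∨-∨ : ∀ a b c d → χ (a ∧ (b ∨ (c ∨ d))) ≤ χ (a ∧ b) + (χ a * χ c + χ a * χ d)
χ-∧-∨-∨ false _     _     _     = z≤n
χ-∧-∨-∨ true  true  _     _     = s≤s z≤n
χ-∧-∨-∨ true  false true  _     = s≤s z≤n
χ-∧-∨-∨ true  false false true  = s≤s z≤n
χ-∧-∨-∨ true  false false false = z≤n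

χ-∧-≤ : ∀ {a a′} b → (T b → a ≡ a′) → χ (a ∧ b) ≤ χ a′ * χ b
χ-∧-≤ {a} {a′} false _ = ≤-reflexive (trans (χ-∧ a false) (trans (*-zeroʳ (χ a)) (sym (*-zeroʳ (χ a′)))))
χ-∧-≤ {a} true  a≡a′ = ≤-reflexive (trans (χ-∧ a true) (cong (λ x → χ x * 1) (a≡a′ tt)))

module _ {A : Set} where

  -- Each unordered pair {u, v} is seen from one side only.
  ∑∑-orient : ∀ (xs : List A) (lt : A → A → Bool) → (∀ u v → χ (lt u v) + χ (lt v u) ≤ 1) →
    ∀ (E : A → A → ℕ) →
    ∑[ u ∈ xs ] ∑[ v ∈ xs ] (χ (lt u v) * E u v + χ (lt u v) * E v u) ≤ ∑[ u ∈ xs ] ∑[ v ∈ xs ] E u v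
  ∑∑-orient xs lt asym E = begin
    ∑[ u ∈ xs ] ∑[ v ∈ xs ] (χ (lt u v) * E u v + χ (lt u v) * E v u)
      ≡⟨ ∑-cong xs (λ u → ∑-distrib-+ xs _ _) ⟩
    ∑[ u ∈ xs ] (∑[ v ∈ xs ] (χ (lt u v) * E u v) + ∑[ v ∈ xs ] (χ (lt u v) * E v u))
      ≡⟨ ∑-distrib-+ xs _ _ ⟩
    ∑[ u ∈ xs ] ∑[ v ∈ xs ] (χ (lt u v) * E u v) + ∑[ u ∈ xs ] ∑[ v ∈ xs ] (χ (lt u v) * E v u)
      ≡⟨ cong (∑[ u ∈ xs ] ∑[ v ∈ xs ] (χ (lt u v) * E u v) +_) (∑-comm xs xs (λ u v → χ (lt u v) * E v u)) ⟩
    ∑[ u ∈ xs ] ∑[ v ∈ xs ] (χ (lt u v) * E u v) + ∑[ u ∈ xs ] ∑[ v ∈ xs ] (χ (lt v u) * E u v)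
      ≡⟨ ∑-distrib-+ xs _ _ ⟨
    ∑[ u ∈ xs ] (∑[ v ∈ xs ] (χ (lt u v) * E u v) + ∑[ v ∈ xs ] (χ (lt v u) * E u v))
      ≡⟨ ∑-cong xs (λ u → trans (∑-cong xs (λ v → *-distribʳ-+ (E u v) (χ (lt u v)) _)) (∑-distrib-+ xs _ _)) ⟨
    ∑[ u ∈ xs ] ∑[ v ∈ xs ] ((χ (lt u v) + χ (lt v u)) * E u v)
      ≤⟨ ∑-mono xs (λ u → ∑-mono xs (λ v → ≤-trans (*-monoˡ-≤ (E u v) (asym u v)) (≤-reflexive (+-identityʳ _)))) ⟩
    ∑[ u ∈ xs ] ∑[ v ∈ xs ] E u v
      ∎
    where open ≤-Reasoning

ltV-lex : ∀ {k n} {p q : Fin k} {i j : Fin n} → T (ltV (p , i) (q , j)) →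
          toℕ p < toℕ q ⊎ (toℕ p ≡ toℕ q × toℕ i < toℕ j)
ltV-lex {p = p} {q} {i} {j} t with Equivalence.to (T-∨ {toℕ p <ᵇ toℕ q}) t
... | inj₁ p<q = inj₁ (<ᵇ⇒< _ _ p<q)
... | inj₂ p≡q∧i<j with Equivalence.to (T-∧ {toℕ p ≡ᵇ toℕ q}) p≡q∧i<j
...   | p≡q , i<j = inj₂ (≡ᵇ⇒≡ _ _ p≡q , <ᵇ⇒< _ _ i<j)

ltV-asym : ∀ {k n} (u v : V k n) → χ (ltV u v) + χ (ltV v u) ≤ 1
ltV-asym u@(p , i) v@(q , j) with ltV u v in uv | ltV v u in vu
... | false | _     = χ≤1 _
... | true  | false = ≤-refl
... | true  | true  = ⊥-elim (lex-asym (ltV-lex {p = p} {q} {i} {j} (subst T (sym uv) tt))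
                                      (ltV-lex {p = q} {p} {j} {i} (subst T (sym vu) tt)))
  where
  lex-asym : ∀ {a b c d} → a < b ⊎ (a ≡ b × c < d) → b < a ⊎ (b ≡ a × d < c) → ⊥
  lex-asym (inj₁ a<b)       (inj₁ b<a)       = <-asym a<b b<a
  lex-asym (inj₁ a<b)       (inj₂ (b≡a , _)) = <-irrefl (sym b≡a) a<b
  lex-asym (inj₂ (a≡b , _)) (inj₁ b<a)       = <-irrefl (sym a≡b) b<a
  lex-asym (inj₂ (_ , c<d)) (inj₂ (_ , d<c)) = <-asym c<d d<c

ltV-cross : ∀ {k n} {p q : Fin k} (i j : Fin n) → p ≢ q → ltV (p , i) (q , j) ≡ (toℕ p <ᵇ toℕ q)
ltV-cross {p = p} {q} i j p≢q with toℕ p ≡ᵇ toℕ q in e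
... | true  = ⊥-elim (p≢q (toℕ-injective (≡ᵇ⇒≡ _ _ (subst T (sym e) tt))))
... | false = ∨-identityʳ _

∑-allFin-suc : ∀ {n} (f : Fin (suc n) → ℕ) → ∑ (allFin (suc n)) f ≡ f zero + ∑ (allFin n) (f ∘ suc)
∑-allFin-suc f = cong (λ xs → f zero + sum xs) (trans (map-tabulate suc f) (sym (map-tabulate (λ i → i) (f ∘ suc))))

∑-first-three : ∀ {k′} (f : Fin (3 + k′) → ℕ) → (∀ j → f (suc (suc (suc j))) ≡ 0) →
                ∑ (allFin (3 + k′)) f ≡ f zero + (f (suc zero) + f (suc (suc zero)))
∑-first-three {k′} f vanish = begin
  ∑ (allFin (3 + k′)) f
    ≡⟨ ∑-allFin-suc f ⟩
  f zero + ∑ (allFin (2 + k′)) (λ j → f (suc j))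
    ≡⟨ cong (f zero +_) (∑-allFin-suc (λ j → f (suc j))) ⟩
  f zero + (f (suc zero) + ∑ (allFin (1 + k′)) (λ j → f (suc (suc j))))
    ≡⟨ cong (λ x → f zero + (f (suc zero) + x)) (∑-allFin-suc (λ j → f (suc (suc j)))) ⟩
  f zero + (f (suc zero) + (f (suc (suc zero)) + ∑ (allFin k′) (λ j → f (suc (suc (suc j))))))
    ≡⟨ cong (λ x → f zero + (f (suc zero) + (f (suc (suc zero)) + x))) (∑-zero (allFin k′) vanish) ⟩
  f zero + (f (suc zero) + (f (suc (suc zero)) + 0))
    ≡⟨ cong (λ x → f zero + (f (suc zero) + x)) (+-identityʳ _) ⟩
  f zero + (f (suc zero) + f (suc (suc zero)))
    ∎
  where open ≡-Reasoning

∑-ordered-pairs : ∀ {k′} (s : Fin (3 + k′) → ℕ) → (∀ j → s (suc (suc (suc j))) ≡ 0) →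
  ∑[ p ∈ allFin (3 + k′) ] ∑[ q ∈ allFin (3 + k′) ] (χ (toℕ p <ᵇ toℕ q) * (s p * s q))
    ≡ s zero * s (suc zero) + (s zero * s (suc (suc zero)) + s (suc zero) * s (suc (suc zero)))
∑-ordered-pairs s vanish =
  trans (∑-first-three (λ p → ∑ (allFin _) (row p)) outer-vanish)
    (trans (cong₂ _+_ (∑-first-three (row zero) (inner-vanish zero))
             (cong₂ _+_ (∑-first-three (row (suc zero)) (inner-vanish (suc zero)))
                        (∑-first-three (row (suc (suc zero))) (inner-vanish (suc (suc zero))))))
      (three (s zero) (s (suc zero)) (s (suc (suc zero)))))
  where
  row : Fin _ → Fin _ → ℕ
  row p q = χ (toℕ p <ᵇ toℕ q) * (s p * s q)
  row-zero : ∀ p q → s p * s q ≡ 0 → row p q ≡ 0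
  row-zero p q e = trans (cong (χ (toℕ p <ᵇ toℕ q) *_) e) (*-zeroʳ (χ (toℕ p <ᵇ toℕ q)))
  outer-vanish : ∀ j → ∑ (allFin _) (row (suc (suc (suc j)))) ≡ 0
  outer-vanish j = ∑-zero (allFin _) (λ q → row-zero _ q (cong (_* s q) (vanish j)))
  inner-vanish : ∀ p j → row p (suc (suc (suc j))) ≡ 0
  inner-vanish p j = row-zero p _ (trans (cong (s p *_) (vanish j)) (*-zeroʳ (s p)))
  three : ∀ a b c → (0 * (a * a) + (1 * (a * b) + 1 * (a * c))) + ((0 * (b * a) + (0 * (b * b) + 1 * (b * c)))
                      + (0 * (c * a) + (0 * (c * b) + 0 * (c * c)))) ≡ a * b + (a * c + b * c)
  three = solve-∀

∑-allFin-const : ∀ n c → ∑[ i ∈ allFin n ] c ≡ n * c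
∑-allFin-const zero    c = refl
∑-allFin-const (suc n) c = trans (∑-allFin-suc {n} (λ _ → c)) (cong (c +_) (∑-allFin-const n c))

-- Simple paths

module _ {A : Set} where

  last-∷ʳ : ∀ (xs : List A) x → last (xs ∷ʳ x) ≡ just x
  last-∷ʳ []           x = refl
  last-∷ʳ (_ ∷ [])     x = refl
  last-∷ʳ (_ ∷ y ∷ ys) x = last-∷ʳ (y ∷ ys) x

  last-reverse : ∀ (xs : List A) → last (reverse xs) ≡ head xs
  last-reverse []       = refl
  last-reverse (x ∷ xs) = trans (cong last (unfold-reverse x xs)) (last-∷ʳ (reverse xs) x)

  head-reverse : ∀ (xs : List A) → head (reverse xs) ≡ last xs
  head-reverse xs = trans (sym (last-reverse (reverse xs))) (cong last (reverse-involutive xs))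

  Unique-reverse : ∀ {xs : List A} → Unique xs → Unique (reverse xs)
  Unique-reverse {xs} = Permutationₛ.Unique-resp-↭ (setoid A) (↭⇒↭ₛ (↭-sym (↭-reverse xs)))

  All≢-reverse : ∀ {x : A} {xs} → All (x ≢_) xs → All (x ≢_) (reverse xs)
  All≢-reverse x∉xs = ¬Any⇒All¬ _ (All¬⇒¬Any x∉xs ∘ reverse⁻)

  Linked-reverse : ∀ {R : Rel A 0ℓ} → Symmetric R → ∀ {xs} → Linked R xs → Linked R (reverse xs)
  Linked-reverse sym-R []  = []
  Linked-reverse sym-R [-] = [-]
  Linked-reverse {R} sym-R {x ∷ y ∷ ys} (Rxy ∷ Ryys) =
    subst (Linked R) (sym (unfold-reverse x (y ∷ ys)))
      (Linkedₚ.++⁺ (Linked-reverse sym-R Ryys) connect [-])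
    where
    connect : Connected R (last (reverse (y ∷ ys))) (just x)
    connect = subst (λ z → Connected R z (just x)) (sym (last-reverse (y ∷ ys))) (just (sym-R Rxy))

  lookup-injective : ∀ {xs : List A} → Unique xs → Injective _≡_ _≡_ (lookup xs)
  lookup-injective {x ∷ xs} (x∉xs ∷ _)  {zero}  {zero}  _ = refl
  lookup-injective {x ∷ xs} (x∉xs ∷ _)  {zero}  {suc j} e = ⊥-elim (All.lookup x∉xs (∈-lookup j) e)
  lookup-injective {x ∷ xs} (x∉xs ∷ _)  {suc i} {zero}  e = ⊥-elim (All.lookup x∉xs (∈-lookup i) (sym e))
  lookup-injective {x ∷ xs} (_ ∷ uniq)   {suc i} {suc j} e = cong suc (lookup-injective uniq e)

  lookup-linked : ∀ {R : Rel A 0ℓ} {xs} → Linked R xs → ∀ {i j : Fin (length xs)} →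
                  toℕ j ≡ suc (toℕ i) → R (lookup xs i) (lookup xs j)
  lookup-linked (Rxy ∷ _)    {zero}  {suc zero} _ = Rxy
  lookup-linked (_ ∷ linked) {suc i} {suc j}    e = lookup-linked linked (suc-injective e)
  lookup-linked [-]          {zero}  {suc ()}   _

  lookup-head : ∀ {xs : List A} {i : Fin (length xs)} → toℕ i ≡ 0 → head xs ≡ just (lookup xs i)
  lookup-head {x ∷ xs} {zero} _ = refl

  lookup-last : ∀ {xs : List A} {i : Fin (length xs)} → toℕ i ≡ length xs ∸ 1 → last xs ≡ just (lookup xs i)
  lookup-last {x ∷ []}     {zero}  _ = refl
  lookup-last {x ∷ y ∷ ys} {suc i} e = lookup-last {y ∷ ys} (suc-injective e)
  lookup-last {x ∷ y ∷ ys} {zero}  ()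

  cycle-of-list : ∀ {R : Rel A 0ℓ} {xs a b} → Unique xs → Linked R xs →
                  head xs ≡ just a → last xs ≡ just b → R b a → HasCycle (length xs) R
  cycle-of-list {R} {xs} uniq linked head≡ last≡ Rba = lookup xs , lookup-injective uniq , adjacent
    where
    adjacent : ∀ i j → CycSucc i j → R (lookup xs i) (lookup xs j)
    adjacent i j (inj₁ j≡1+i)         = lookup-linked linked j≡1+i
    adjacent i j (inj₂ (i≡end , j≡0)) =
      subst₂ R (just-injective (trans (sym last≡) (lookup-last {xs} i≡end)))
               (just-injective (trans (sym head≡) (lookup-head {xs} j≡0))) Rba

record Path {A : Set} (R : Rel A 0ℓ) (a b : A) (L : ℕ) : Set where
  field
    vertices : List A
    length≡  : length vertices ≡ L
    unique   : Unique vertices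
    linked   : Linked R vertices
    head≡    : head vertices ≡ just a
    last≡    : last vertices ≡ just b

open Path

module _ {A : Set} {R : Rel A 0ℓ} where

  single : ∀ a → Path R a a 1
  single a = record
    { vertices = a ∷ [] ; length≡ = refl ; unique = [] ∷ [] ; linked = [-] ; head≡ = refl ; last≡ = refl }

  last-∷ : ∀ x {xs : List A} {a} → head xs ≡ just a → last (x ∷ xs) ≡ last xs
  last-∷ x {_ ∷ _} _ = refl

  prepend : ∀ x {a b L} (p : Path R a b L) → R x a → All (x ≢_) (vertices p) → Path R x b (suc L)
  prepend x p Rxa x∉p = record
    { vertices = x ∷ vertices p
    ; length≡  = cong suc (length≡ p)
    ; unique   = x∉p ∷ unique p
    ; linked   = subst (Connected R (just x)) (sym (head≡ p)) (just Rxa) Linked.∷′ linked p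
    ; head≡    = refl
    ; last≡    = trans (last-∷ x (head≡ p)) (last≡ p)
    }

  reversePath : Symmetric R → ∀ {a b L} → Path R a b L → Path R b a L
  reversePath sym-R p = record
    { vertices = reverse (vertices p)
    ; length≡  = trans (length-reverse (vertices p)) (length≡ p)
    ; unique   = Unique-reverse (unique p)
    ; linked   = Linked-reverse sym-R (linked p)
    ; head≡    = trans (head-reverse (vertices p)) (last≡ p)
    ; last≡    = trans (last-reverse (vertices p)) (head≡ p)
    }

  closePath : ∀ {a b L} → Path R a b L → R b a → HasCycle L R
  closePath p Rba =
    subst (λ L → HasCycle L R) (length≡ p) (cycle-of-list (unique p) (linked p) (head≡ p) (last≡ p) Rba)

mapPath : ∀ {A B : Set} {R : Rel A 0ℓ} {S : Rel B 0ℓ} (f : A → B) → Injective _≡_ _≡_ f →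
          (∀ {x y} → R x y → S (f x) (f y)) → ∀ {a b L} → Path R a b L → Path S (f a) (f b) L
mapPath f f-inj f-hom p = record
  { vertices = map f (vertices p)
  ; length≡  = trans (length-map f (vertices p)) (length≡ p)
  ; unique   = Uniqueₚ.map⁺ f-inj (unique p)
  ; linked   = Linkedₚ.map⁺ (Linked.map f-hom (linked p))
  ; head≡    = trans (head-map (vertices p)) (cong (Maybe.map f) (head≡ p))
  ; last≡    = trans (last-map f (vertices p)) (cong (Maybe.map f) (last≡ p))
  }

All≢-map : ∀ {A B : Set} {x : B} (f : A → B) → (∀ v → x ≢ f v) → ∀ vs → All (x ≢_) (map f vs)
All≢-map f x∉f vs = Allₚ.map⁺ (All.universal x∉f vs)

cyc-pred : ∀ {N} (i : Fin (suc N)) → Σ (Fin (suc N)) λ j → CycSucc j i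
cyc-pred {N} zero = fromℕ N , inj₂ (toℕ-fromℕ N , refl)
cyc-pred (suc i)  = inject₁ i , inj₁ (cong suc (sym (toℕ-inject₁ i)))

cyc-succ : ∀ {N} (i : Fin (suc N)) → Σ (Fin (suc N)) λ j → CycSucc i j
cyc-succ {N} i with toℕ i <? N
... | yes i<N = fromℕ< (s≤s i<N) , inj₁ (toℕ-fromℕ< (s≤s i<N))
... | no  i≮N = zero , inj₂ (≤-antisym (≤-pred (toℕ<n i)) (≮⇒≥ i≮N) , refl)

CycSucc-distinct : ∀ {ℓ} {i j j′ : Fin ℓ} → 3 ≤ ℓ → CycSucc j i → CycSucc i j′ → j ≢ j′
CycSucc-distinct _ (inj₁ i≡1+j) (inj₁ j≡1+i) refl = m≢1+n+m _ (trans i≡1+j (cong suc j≡1+i))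
CycSucc-distinct (s≤s (s≤s (s≤s _))) (inj₁ i≡1+j) (inj₂ (i≡top , j≡0)) refl
  with () ← trans (sym i≡top) (trans i≡1+j (cong suc j≡0))
CycSucc-distinct (s≤s (s≤s (s≤s _))) (inj₂ (j≡top , i≡0)) (inj₁ j≡1+i) refl
  with () ← trans (sym j≡top) (trans j≡1+i (cong suc i≡0))
CycSucc-distinct (s≤s (s≤s (s≤s _))) (inj₂ (_ , i≡0)) (inj₂ (i≡top , _)) refl
  with () ← trans (sym i≡0) i≡top

-- A graph whose vertices outside an N-element labelled set all have at most one
-- neighbour has no cycle of length N + 1: such a cycle cannot visit a pendant
-- vertex, so it injects into the labels.
no-long-cycle : ∀ {W : Set} {R : Rel W 0ℓ} {N} → 2 ≤ N → Symmetric R →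
  (label : W → Maybe (Fin N)) → (∀ {w w′ t} → label w ≡ just t → label w′ ≡ just t → w ≡ w′) →
  (anchor : W → W) → (∀ {w x} → label w ≡ nothing → R w x → x ≡ anchor w) →
  ¬ HasCycle (suc N) R
no-long-cycle {N = N} 2≤N R-sym label label-injective anchor pendant (f , f-injective , f-adjacent) =
  <⇒notInjective ≤-refl g-injective
  where
  labelled : ∀ i → label (f i) ≢ nothing
  labelled i unlabelled with j , j→i ← cyc-pred i | j′ , i→j′ ← cyc-succ i =
    CycSucc-distinct (s≤s 2≤N) j→i i→j′
      (f-injective (trans (pendant unlabelled (R-sym (f-adjacent j i j→i)))
                          (sym (pendant unlabelled (f-adjacent i j′ i→j′)))))

  label-of : ∀ i → Σ (Fin N) λ t → label (f i) ≡ just t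
  label-of i with label (f i) in eq
  ... | just t  = t , refl
  ... | nothing = ⊥-elim (labelled i eq)

  g : Fin (suc N) → Fin N
  g i = proj₁ (label-of i)

  g-injective : Injective _≡_ _≡_ g
  g-injective {i} {j} gi≡gj =
    f-injective (label-injective (proj₂ (label-of i))
                                 (subst (λ t → label (f j) ≡ just t) (sym gi≡gj) (proj₂ (label-of j))))

-- Transpositions

module _ {A : Set} (_≟_ : DecidableEquality A) where

  transpose : A → A → A → A
  transpose a b x with x ≟ a
  ... | yes _ = b
  ... | no _ with x ≟ b
  ...   | yes _ = a
  ...   | no _  = x

  transpose-left : ∀ a b → transpose a b a ≡ b
  transpose-left a b with a ≟ a
  ... | yes _  = refl
  ... | no a≢a = ⊥-elim (a≢a refl)

  transpose-right : ∀ a b → transpose a b b ≡ a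
  transpose-right a b with b ≟ a
  ... | yes refl = refl
  ... | no _ with b ≟ b
  ...   | yes _  = refl
  ...   | no b≢b = ⊥-elim (b≢b refl)

  transpose-other : ∀ {a b x} → x ≢ a → x ≢ b → transpose a b x ≡ x
  transpose-other {a} {b} {x} x≢a x≢b with x ≟ a
  ... | yes x≡a = ⊥-elim (x≢a x≡a)
  ... | no _ with x ≟ b
  ...   | yes x≡b = ⊥-elim (x≢b x≡b)
  ...   | no _    = refl

  transpose-involutive : ∀ a b x → transpose a b (transpose a b x) ≡ x
  transpose-involutive a b x with x ≟ a
  ... | yes refl = transpose-right x b
  ... | no x≢a with x ≟ b
  ...   | yes refl = transpose-left a x
  ...   | no x≢b   = transpose-other x≢a x≢b

  transpose-injective : ∀ a b → Injective _≡_ _≡_ (transpose a b)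
  transpose-injective a b {x} {y} e =
    trans (sym (transpose-involutive a b x)) (trans (cong (transpose a b) e) (transpose-involutive a b y))

  transpose-invariant : ∀ {B : Set} (f : A → B) {a b} → f a ≡ f b → ∀ x → f (transpose a b x) ≡ f x
  transpose-invariant f {a} {b} fa≡fb x with x ≟ a
  ... | yes refl = sym fa≡fb
  ... | no _ with x ≟ b
  ...   | yes refl = fa≡fb
  ...   | no _     = refl

  two-point-transitive : ∀ {B : Set} (f : A → B) {e₁ e₂ a b} → e₁ ≢ e₂ → a ≢ b →
    f e₁ ≡ f a → f e₂ ≡ f b →
    Σ (A → A) λ σ → Injective _≡_ _≡_ σ × (∀ x → f (σ x) ≡ f x) × σ e₁ ≡ a × σ e₂ ≡ b
  two-point-transitive f {e₁} {e₂} {a} {b} e₁≢e₂ a≢b fe₁≡fa fe₂≡fb =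
    σ , σ-injective , σ-invariant , σe₁≡a , σe₂≡b
    where
    b′ : A
    b′ = transpose e₁ a b
    σ : A → A
    σ = transpose e₁ a ∘ transpose e₂ b′
    fe₂≡fb′ : f e₂ ≡ f b′
    fe₂≡fb′ = trans fe₂≡fb (sym (transpose-invariant f fe₁≡fa b))
    σ-injective : Injective _≡_ _≡_ σ
    σ-injective = transpose-injective e₂ b′ ∘ transpose-injective e₁ a
    σ-invariant : ∀ x → f (σ x) ≡ f x
    σ-invariant x = trans (transpose-invariant f fe₁≡fa _) (transpose-invariant f fe₂≡fb′ x)
    e₁≢b′ : e₁ ≢ b′
    e₁≢b′ e₁≡b′ = a≢b (trans (sym (transpose-left e₁ a))
                             (trans (cong (transpose e₁ a) e₁≡b′) (transpose-involutive e₁ a b)))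
    σe₁≡a : σ e₁ ≡ a
    σe₁≡a = trans (cong (transpose e₁ a) (transpose-other e₁≢e₂ e₁≢b′)) (transpose-left e₁ a)
    σe₂≡b : σ e₂ ≡ b
    σe₂≡b = trans (cong (transpose e₁ a) (transpose-left e₂ b′)) (transpose-involutive e₁ a b)

-- The core K_{m,m,r}

Core : ℕ → ℕ → Set
Core m r = Fin r ⊎ (Fin m ⊎ Fin m)

pattern Z z = inj₁ z
pattern X i = inj₂ (inj₁ i)
pattern Y i = inj₂ (inj₂ i)

module _ {m r : ℕ} where

  part : Core m r → Fin 3
  part (X _) = zero
  part (Y _) = suc zero
  part (Z _) = suc (suc zero)

  Adj : Rel (Core m r) 0ℓ
  Adj c d = part c ≢ part d

  Adj-sym : Symmetric Adj
  Adj-sym c≁d d≡c = c≁d (sym d≡c)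

  _≟ᶜ_ : DecidableEquality (Core m r)
  _≟ᶜ_ = Sumₚ.≡-dec Finₚ._≟_ (Sumₚ.≡-dec Finₚ._≟_ Finₚ._≟_)

  transport : ∀ {e₁ e₂ a b L} → Path Adj e₁ e₂ L → e₁ ≢ e₂ → a ≢ b →
              part e₁ ≡ part a → part e₂ ≡ part b → Path Adj a b L
  transport {L = L} p e₁≢e₂ a≢b e₁∼a e₂∼b with two-point-transitive _≟ᶜ_ part e₁≢e₂ a≢b e₁∼a e₂∼b
  ... | σ , σ-injective , σ-invariant , σe₁≡a , σe₂≡b =
    subst₂ (λ x y → Path Adj x y L) σe₁≡a σe₂≡b (mapPath σ σ-injective σ-hom p)
    where
    σ-hom : ∀ {x y} → Adj x y → Adj (σ x) (σ y)
    σ-hom {x} {y} x≁y σx∼σy = x≁y (trans (sym (σ-invariant x)) (trans σx∼σy (σ-invariant y)))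

  swapXY : Core m r → Core m r
  swapXY (X i) = Y i
  swapXY (Y i) = X i
  swapXY (Z z) = Z z

  swapXY-involutive : ∀ c → swapXY (swapXY c) ≡ c
  swapXY-involutive (X _) = refl
  swapXY-involutive (Y _) = refl
  swapXY-involutive (Z _) = refl

  swapXY-hom : ∀ {c d} → Adj c d → Adj (swapXY c) (swapXY d)
  swapXY-hom {X _} {Y _} _ = λ ()
  swapXY-hom {X _} {Z _} _ = λ ()
  swapXY-hom {Y _} {X _} _ = λ ()
  swapXY-hom {Y _} {Z _} _ = λ ()
  swapXY-hom {Z _} {X _} _ = λ ()
  swapXY-hom {Z _} {Y _} _ = λ ()
  swapXY-hom {X _} {X _} c≁d = ⊥-elim (c≁d refl)
  swapXY-hom {Y _} {Y _} c≁d = ⊥-elim (c≁d refl)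
  swapXY-hom {Z _} {Z _} c≁d = ⊥-elim (c≁d refl)

  swapPath : ∀ {a b L} → Path Adj a b L → Path Adj (swapXY a) (swapXY b) L
  swapPath = mapPath swapXY swapXY-injective swapXY-hom
    where
    swapXY-injective : Injective _≡_ _≡_ swapXY
    swapXY-injective {c} {d} e = trans (sym (swapXY-involutive c)) (trans (cong swapXY e) (swapXY-involutive d))

raise : ∀ {m r} → Core m 0 → Core (suc m) r
raise (X i) = X (suc i)
raise (Y i) = Y (suc i)

raisePath : ∀ {m r a b L} → Path Adj a b L → Path (Adj {suc m} {r}) (raise a) (raise b) L
raisePath = mapPath raise raise-injective raise-hom
  where
  raise-injective : ∀ {m r} → Injective _≡_ _≡_ (raise {m} {r})
  raise-injective {x = X _} {X _} refl = refl
  raise-injective {x = Y _} {Y _} refl = refl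
  raise-hom : ∀ {m r} {c d : Core m 0} → Adj c d → Adj (raise {m} {r} c) (raise d)
  raise-hom {c = X _} {X _} c≁d = c≁d
  raise-hom {c = X _} {Y _} c≁d = c≁d
  raise-hom {c = Y _} {X _} c≁d = c≁d
  raise-hom {c = Y _} {Y _} c≁d = c≁d

X₀∉raise : ∀ {m r} (v : Core m 0) → X zero ≢ raise {r = r} v
X₀∉raise (X _) ()
X₀∉raise (Y _) ()

Y₀∉raise : ∀ {m r} (v : Core m 0) → Y zero ≢ raise {r = r} v
Y₀∉raise (X _) ()
Y₀∉raise (Y _) ()

Z∉raise : ∀ {m r} (z : Fin r) (v : Core m 0) → Z z ≢ raise v
Z∉raise z (X _) ()
Z∉raise z (Y _) ()

-- A Hamiltonian path X 0, Y 0, X 1, Y 1, …, X j, Y j of K_{j+1,j+1,0}.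
zigzag : ∀ j → Path (Adj {suc j} {0}) (X zero) (Y (fromℕ j)) (suc j + suc j)
zigzag zero    = prepend (X zero) (single (Y zero)) (λ ()) ((λ ()) ∷ [])
zigzag (suc j) = subst (Path Adj (X zero) (Y (fromℕ (suc j)))) (cong suc (sym (+-suc (suc j) (suc j))))
  (prepend (X zero) (prepend (Y zero) (raisePath (zigzag j)) (λ ()) (All≢-map raise Y₀∉raise _)) (λ ())
    ((λ ()) ∷ All≢-map raise X₀∉raise _))

record Seeds (p r′ L : ℕ) : Set where
  field
    X→X : Path (Adj {suc (suc p)} {suc r′}) (X zero) (X (fromℕ (suc p))) L
    X→Y : Path (Adj {suc (suc p)} {suc r′}) (X zero) (Y (fromℕ (suc p))) L
    Z→X : Path (Adj {suc (suc p)} {suc r′}) (Z zero) (X (fromℕ (suc p))) L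
    Z→Z : ∀ {i j} → i ≢ j → Path (Adj {suc (suc p)} {suc r′}) (Z i) (Z j) L

open Seeds

-- Part-preserving permutations, swapXY and reversal move the seeds onto any two distinct vertices.
connect : ∀ {p r′ L} → Seeds p r′ L → (a b : Core (suc (suc p)) (suc r′)) → a ≢ b → Path Adj a b L
connect s (X _) (X _) a≢b = transport (X→X s) (λ ()) a≢b refl refl
connect s (Y _) (Y _) a≢b = transport (swapPath (X→X s)) (λ ()) a≢b refl refl
connect s (X _) (Y _) a≢b = transport (X→Y s) (λ ()) a≢b refl refl
connect s (Y _) (X _) a≢b = transport (swapPath (X→Y s)) (λ ()) a≢b refl refl
connect s (Z _) (X _) a≢b = transport (Z→X s) (λ ()) a≢b refl refl
connect s (Z _) (Y _) a≢b = transport (swapPath (Z→X s)) (λ ()) a≢b refl refl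
connect s (X _) (Z _) a≢b = transport (reversePath Adj-sym (Z→X s)) (λ ()) a≢b refl refl
connect s (Y _) (Z _) a≢b = transport (reversePath Adj-sym (swapPath (Z→X s))) (λ ()) a≢b refl refl
connect s (Z _) (Z _) a≢b = Z→Z s (λ i≡j → a≢b (cong Z i≡j))

seeds-length : ∀ j p → suc (suc j) + (suc p + suc p) ≡ j + (suc (suc p) + suc (suc p))
seeds-length = solve-∀

module _ (p : ℕ) where

  -- ⟨XY⟩ is X 1, Y 1, …, X (p+1), Y (p+1) and ⟨YX⟩ its swap; the paths below prefix them with the
  -- vertices named in their names.
  private
    top : Fin (suc (suc p))
    top = fromℕ (suc p)

    ⟨XY⟩ : ∀ {r} → Path (Adj {suc (suc p)} {r}) (X (suc zero)) (Y top) (suc p + suc p)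
    ⟨XY⟩ = raisePath (zigzag p)

    ⟨YX⟩ : ∀ {r} → Path (Adj {suc (suc p)} {r}) (Y (suc zero)) (X top) (suc p + suc p)
    ⟨YX⟩ = raisePath (swapPath (zigzag p))

    X₀-new : ∀ {r} vs → All (X zero ≢_) (map (raise {suc p} {r}) vs)
    X₀-new = All≢-map raise X₀∉raise

    Y₀-new : ∀ {r} vs → All (Y zero ≢_) (map (raise {suc p} {r}) vs)
    Y₀-new = All≢-map raise Y₀∉raise

    Z-new : ∀ {r} (z : Fin r) vs → All (Z z ≢_) (map (raise {suc p}) vs)
    Z-new z = All≢-map raise (Z∉raise z)

  module _ {r′ : ℕ} where

    X₀Z₀⟨YX⟩ : Path (Adj {suc (suc p)} {suc r′}) (X zero) (X top) (2 + (suc p + suc p))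
    X₀Z₀⟨YX⟩ = prepend (X zero) (prepend (Z zero) ⟨YX⟩ (λ ()) (Z-new zero _)) (λ ()) ((λ ()) ∷ X₀-new _)

    X₀Y₀⟨XY⟩ : Path (Adj {suc (suc p)} {suc r′}) (X zero) (Y top) (2 + (suc p + suc p))
    X₀Y₀⟨XY⟩ = prepend (X zero) (prepend (Y zero) ⟨XY⟩ (λ ()) (Y₀-new _)) (λ ()) ((λ ()) ∷ X₀-new _)

    Z₀X₀⟨YX⟩ : Path (Adj {suc (suc p)} {suc r′}) (Z zero) (X top) (2 + (suc p + suc p))
    Z₀X₀⟨YX⟩ = prepend (Z zero) (prepend (X zero) ⟨YX⟩ (λ ()) (X₀-new _)) (λ ()) ((λ ()) ∷ Z-new zero _)

    X₀Y₀Z₀⟨YX⟩ : Path (Adj {suc (suc p)} {suc r′}) (X zero) (X top) (3 + (suc p + suc p))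
    X₀Y₀Z₀⟨YX⟩ = prepend (X zero) (prepend (Y zero) (prepend (Z zero) ⟨YX⟩ (λ ()) (Z-new zero _))
      (λ ()) ((λ ()) ∷ Y₀-new _)) (λ ()) ((λ ()) ∷ (λ ()) ∷ X₀-new _)

    X₀Y₀Z₀⟨XY⟩ : Path (Adj {suc (suc p)} {suc r′}) (X zero) (Y top) (3 + (suc p + suc p))
    X₀Y₀Z₀⟨XY⟩ = prepend (X zero) (prepend (Y zero) (prepend (Z zero) ⟨XY⟩ (λ ()) (Z-new zero _))
      (λ ()) ((λ ()) ∷ Y₀-new _)) (λ ()) ((λ ()) ∷ (λ ()) ∷ X₀-new _)

    Z₀Y₀X₀⟨YX⟩ : Path (Adj {suc (suc p)} {suc r′}) (Z zero) (X top) (3 + (suc p + suc p))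
    Z₀Y₀X₀⟨YX⟩ = prepend (Z zero) (prepend (Y zero) (prepend (X zero) ⟨YX⟩ (λ ()) (X₀-new _))
      (λ ()) ((λ ()) ∷ Y₀-new _)) (λ ()) ((λ ()) ∷ (λ ()) ∷ Z-new zero _)

  X₀Z₁Y₀Z₀⟨YX⟩ : Path (Adj {suc (suc p)} {2}) (X zero) (X top) (4 + (suc p + suc p))
  X₀Z₁Y₀Z₀⟨YX⟩ = prepend (X zero) (prepend (Z (suc zero)) (prepend (Y zero) (prepend (Z zero) ⟨YX⟩
    (λ ()) (Z-new zero _)) (λ ()) ((λ ()) ∷ Y₀-new _)) (λ ()) ((λ ()) ∷ (λ ()) ∷ Z-new (suc zero) _))
    (λ ()) ((λ ()) ∷ (λ ()) ∷ (λ ()) ∷ X₀-new _)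

  X₀Z₁Y₀Z₀⟨XY⟩ : Path (Adj {suc (suc p)} {2}) (X zero) (Y top) (4 + (suc p + suc p))
  X₀Z₁Y₀Z₀⟨XY⟩ = prepend (X zero) (prepend (Z (suc zero)) (prepend (Y zero) (prepend (Z zero) ⟨XY⟩
    (λ ()) (Z-new zero _)) (λ ()) ((λ ()) ∷ Y₀-new _)) (λ ()) ((λ ()) ∷ (λ ()) ∷ Z-new (suc zero) _))
    (λ ()) ((λ ()) ∷ (λ ()) ∷ (λ ()) ∷ X₀-new _)

  Z₀Y₀Z₁X₀⟨YX⟩ : Path (Adj {suc (suc p)} {2}) (Z zero) (X top) (4 + (suc p + suc p))
  Z₀Y₀Z₁X₀⟨YX⟩ = prepend (Z zero) (prepend (Y zero) (prepend (Z (suc zero)) (prepend (X zero) ⟨YX⟩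
    (λ ()) (X₀-new _)) (λ ()) ((λ ()) ∷ Z-new (suc zero) _)) (λ ()) ((λ ()) ∷ (λ ()) ∷ Y₀-new _))
    (λ ()) ((λ ()) ∷ (λ ()) ∷ (λ ()) ∷ Z-new zero _)

  Z-pair : ∀ {L} (q : Path (Adj {suc (suc p)} {2}) (Z zero) (X top) L) → All (Z (suc zero) ≢_) (Path.vertices q) →
           ∀ {i j : Fin 2} → i ≢ j → Path (Adj {suc (suc p)}) (Z i) (Z j) (suc L)
  Z-pair q Z₁∉q {zero}     {zero}     i≢j = ⊥-elim (i≢j refl)
  Z-pair q Z₁∉q {suc zero} {suc zero} i≢j = ⊥-elim (i≢j refl)
  Z-pair q Z₁∉q {suc zero} {zero}     _   =
    prepend (Z (suc zero)) (reversePath Adj-sym q) (λ ()) (All≢-reverse {xs = vertices q} Z₁∉q)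
  Z-pair q Z₁∉q {zero}     {suc zero} _   = reversePath Adj-sym (Z-pair q Z₁∉q {suc zero} {zero} (λ ()))

  spanning-path : ∀ r′ → r′ ≤ 1 → (a b : Core (suc (suc p)) (suc r′)) → a ≢ b →
                  Path Adj a b (suc r′ + (suc (suc p) + suc (suc p)))
  spanning-path zero _ a b a≢b = subst (Path Adj a b) (seeds-length 1 p) (connect seeds a b a≢b)
    where
    seeds : Seeds p 0 (3 + (suc p + suc p))
    seeds = record { X→X = X₀Y₀Z₀⟨YX⟩ ; X→Y = X₀Y₀Z₀⟨XY⟩ ; Z→X = Z₀Y₀X₀⟨YX⟩
                   ; Z→Z = λ { {zero} {zero} i≢j → ⊥-elim (i≢j refl) } }
  spanning-path (suc (suc _)) (s≤s ())
  spanning-path (suc zero) _ a b a≢b = subst (Path Adj a b) (seeds-length 2 p) (connect seeds a b a≢b)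
    where
    seeds : Seeds p 1 (4 + (suc p + suc p))
    seeds = record { X→X = X₀Z₁Y₀Z₀⟨YX⟩ ; X→Y = X₀Z₁Y₀Z₀⟨XY⟩ ; Z→X = Z₀Y₀Z₁X₀⟨YX⟩
                   ; Z→Z = Z-pair Z₀Y₀X₀⟨YX⟩ ((λ ()) ∷ (λ ()) ∷ (λ ()) ∷ Z-new (suc zero) _) }

  near-spanning-path : ∀ r′ → r′ ≤ 1 → (a b : Core (suc (suc p)) (suc r′)) → a ≢ b →
                       Path Adj a b (r′ + (suc (suc p) + suc (suc p)))
  near-spanning-path zero _ a b a≢b = subst (Path Adj a b) (seeds-length 0 p) (connect seeds a b a≢b)
    where
    seeds : Seeds p 0 (2 + (suc p + suc p))
    seeds = record { X→X = X₀Z₀⟨YX⟩ ; X→Y = X₀Y₀⟨XY⟩ ; Z→X = Z₀X₀⟨YX⟩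
                   ; Z→Z = λ { {zero} {zero} i≢j → ⊥-elim (i≢j refl) } }
  near-spanning-path (suc (suc _)) (s≤s ())
  near-spanning-path (suc zero) _ a b a≢b = subst (Path Adj a b) (seeds-length 1 p) (connect seeds a b a≢b)
    where
    seeds : Seeds p 1 (3 + (suc p + suc p))
    seeds = record { X→X = X₀Y₀Z₀⟨YX⟩ ; X→Y = X₀Y₀Z₀⟨XY⟩ ; Z→X = Z₀Y₀X₀⟨YX⟩
                   ; Z→Z = Z-pair Z₀X₀⟨YX⟩ ((λ ()) ∷ (λ ()) ∷ Z-new (suc zero) _) }

-- The graph in K_k^n

shrink : ∀ {n} → Fin n → (b : ℕ) → Maybe (Fin b)
shrink zero    zero    = nothing
shrink zero    (suc b) = just zero
shrink (suc i) zero    = nothing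
shrink (suc i) (suc b) = Maybe.map suc (shrink i b)

shrink-inject≤ : ∀ {b n} (j : Fin b) (b≤n : b ≤ n) → shrink (inject≤ j b≤n) b ≡ just j
shrink-inject≤ zero    (s≤s _)   = refl
shrink-inject≤ (suc j) (s≤s b≤n) = cong (Maybe.map suc) (shrink-inject≤ j b≤n)

inject≤-shrink : ∀ {b n} (i : Fin n) {j : Fin b} (b≤n : b ≤ n) → shrink i b ≡ just j → inject≤ j b≤n ≡ i
inject≤-shrink {suc b} zero    (s≤s _) refl = refl
inject≤-shrink {suc b} (suc i) (s≤s b≤n) e with shrink i b in eq
inject≤-shrink {suc b} (suc i) (s≤s b≤n) refl | just j = cong suc (inject≤-shrink i b≤n eq)

is-just-map : ∀ {A B : Set} (f : A → B) x → is-just (Maybe.map f x) ≡ is-just x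
is-just-map f (just _) = refl
is-just-map f nothing  = refl

count-shrink : ∀ {n} b → b ≤ n → ∑[ i ∈ allFin n ] χ (is-just (shrink i b)) ≡ b
count-shrink {n}     zero    _         = ∑-zero (allFin n) shrink-zero
  where
  shrink-zero : ∀ {n} (i : Fin n) → χ (is-just (shrink i 0)) ≡ 0
  shrink-zero zero    = refl
  shrink-zero (suc _) = refl
count-shrink {suc n} (suc b) (s≤s b≤n) =
  trans (∑-allFin-suc {n} (λ i → χ (is-just (shrink i (suc b)))))
    (cong suc (trans (∑-cong (allFin n) (λ i → cong χ (is-just-map Fin.suc (shrink i b)))) (count-shrink b b≤n)))

-- Enumerates Z 0, …, Z (r-1), X 0, X 1, …; so for r ≤ 2 and m ≥ 2 its q-th element avoids part q.
Fin↔Core : ∀ {m r} → Fin (r + (m + m)) ↔ Core m r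
Fin↔Core = ↔-trans +↔⊎ (↔-refl ⊎-↔ +↔⊎)

module _ {k′ p r′ : ℕ} (k≤N : 3 + k′ ≤ suc r′ + (suc (suc p) + suc (suc p))) where

  host : Fin (3 + k′) → Core (suc (suc p)) (suc r′)
  host q = Inverse.to Fin↔Core (inject≤ q k≤N)

  host-injective : Injective _≡_ _≡_ host
  host-injective e = Finₚ.inject≤-injective k≤N k≤N _ _ (Injection.injective (↔⇒↣ Fin↔Core) e)

  host-outside : r′ ≤ 1 → ∀ q → part (host q) ↑ˡ k′ ≢ q
  host-outside _       zero                = λ ()
  host-outside z≤n     (suc zero)          = λ ()
  host-outside (s≤s z≤n) (suc zero)        = λ ()
  host-outside z≤n     (suc (suc zero))    = λ ()
  host-outside (s≤s z≤n) (suc (suc zero))  = λ ()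
  host-outside _       (suc (suc (suc q))) = part-↑ˡ (host (suc (suc (suc q))))
    where
    part-↑ˡ : ∀ c → part c ↑ˡ k′ ≢ suc (suc (suc q))
    part-↑ˡ (X _) ()
    part-↑ˡ (Y _) ()
    part-↑ˡ (Z _) ()

module Construction (k′ n p r′ : ℕ) (r′≤1 : r′ ≤ 1) (m≤n : suc (suc p) ≤ n)
                    (k≤N : 3 + k′ ≤ suc r′ + (suc (suc p) + suc (suc p))) where

  k m r N : ℕ
  k = 3 + k′
  m = suc (suc p)
  r = suc r′
  N = r + (m + m)

  C W : Set
  C = Core m r
  W = V k n

  AV : List W
  AV = allV k n

  size : Fin k → ℕ
  size zero                = m
  size (suc zero)          = m
  size (suc (suc zero))    = r
  size (suc (suc (suc _))) = 0

  size≤n : ∀ q → size q ≤ n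
  size≤n zero                = m≤n
  size≤n (suc zero)          = m≤n
  size≤n (suc (suc zero))    = ≤-trans (s≤s r′≤1) (≤-trans (s≤s (s≤s z≤n)) m≤n)
  size≤n (suc (suc (suc _))) = z≤n

  place : (q : Fin k) → Fin (size q) → C
  place zero                i = X i
  place (suc zero)          i = Y i
  place (suc (suc zero))    z = Z z
  place (suc (suc (suc _))) ()

  slot : (c : C) → Fin (size (part c ↑ˡ k′))
  slot (X i) = i
  slot (Y i) = i
  slot (Z z) = z

  place-slot : ∀ c → place (part c ↑ˡ k′) (slot c) ≡ c
  place-slot (X _) = refl
  place-slot (Y _) = refl
  place-slot (Z _) = refl

  embed : C → W
  embed c = part c ↑ˡ k′ , inject≤ (slot c) (size≤n (part c ↑ˡ k′))

  embed-place : ∀ q j → embed (place q j) ≡ (q , inject≤ j (size≤n q))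
  embed-place zero             _ = refl
  embed-place (suc zero)       _ = refl
  embed-place (suc (suc zero)) _ = refl

  classify : W → Maybe C
  classify (q , i) = Maybe.map (place q) (shrink i (size q))

  classify-embed : ∀ c → classify (embed c) ≡ just c
  classify-embed c =
    trans (cong (Maybe.map (place (part c ↑ˡ k′))) (shrink-inject≤ (slot c) (size≤n _))) (cong just (place-slot c))

  embed-classify : ∀ u {c} → classify u ≡ just c → embed c ≡ u
  embed-classify (q , i) e with shrink i (size q) in eq
  embed-classify (q , i) refl | just j = trans (embed-place q j) (cong (q ,_) (inject≤-shrink i (size≤n q) eq))

  embed-injective : Injective _≡_ _≡_ embed
  embed-injective {c} {d} e = just-injective (trans (sym (classify-embed c)) (trans (cong classify e) (classify-embed d)))

  leaf-not-embedded : ∀ {u} → classify u ≡ nothing → ∀ c → u ≢ embed c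
  leaf-not-embedded leaf c refl with () ← trans (sym leaf) (classify-embed c)

  _≟ᵥ_ : DecidableEquality W
  _≟ᵥ_ = Σₚ.≡-dec Finₚ._≟_ Finₚ._≟_

  anchor : W → W
  anchor u = embed (host k≤N (proj₁ u))

  joins : Maybe C → Maybe C → Bool
  joins (just c) (just d) = not ⌊ part c Finₚ.≟ part d ⌋
  joins _        _        = false

  hangs : W → W → Bool
  hangs u v = is-nothing (classify u) ∧ ⌊ v ≟ᵥ anchor u ⌋

  H : Graph k n
  H u v = joins (classify u) (classify v) ∨ (hangs u v ∨ hangs v u)

  joins-sym : ∀ x y → joins x y ≡ joins y x
  joins-sym (just c) (just d) = cong not (trans (isYes≗does (part c Finₚ.≟ part d))
    (trans (does-⇔ (mk⇔ sym sym) (part c Finₚ.≟ part d) (part d Finₚ.≟ part c)) (sym (isYes≗does _))))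
  joins-sym (just _) nothing  = refl
  joins-sym nothing  (just _) = refl
  joins-sym nothing  nothing  = refl

  H-sym : ∀ u v → H u v ≡ H v u
  H-sym u v = cong₂ _∨_ (joins-sym (classify u) (classify v)) (∨-comm (hangs u v) (hangs v u))

  H-cases : ∀ {u v} → T (H u v) → T (joins (classify u) (classify v)) ⊎ (T (hangs u v) ⊎ T (hangs v u))
  H-cases t = Sum.map₂ (Equivalence.to T-∨) (Equivalence.to T-∨ t)

  joins-parts : ∀ {u v} → T (joins (classify u) (classify v)) → proj₁ u ≢ proj₁ v
  joins-parts {u} {v} t with classify u in eu | classify v in ev
  ... | just c | just d = λ pu≡pv → toWitnessFalse {a? = part c Finₚ.≟ part d} t
    (↑ˡ-injective k′ _ _ (trans (cong proj₁ (embed-classify u eu)) (trans pu≡pv (sym (cong proj₁ (embed-classify v ev))))))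

  hangs-anchor : ∀ {u v} → T (hangs u v) → v ≡ anchor u
  hangs-anchor {u} {v} t = toWitness {a? = v ≟ᵥ anchor u} (proj₂ (Equivalence.to (T-∧ {is-nothing (classify u)}) t))

  anchor-part : ∀ u → proj₁ (anchor u) ≢ proj₁ u
  anchor-part u = host-outside k≤N r′≤1 (proj₁ u)

  H-between-parts : ∀ u v → T (H u v) → KAdj u v
  H-between-parts u v t with H-cases {u} {v} t
  ... | inj₁ j = joins-parts {u} {v} j
  ... | inj₂ (inj₁ h) = λ pu≡pv → anchor-part u (trans (cong proj₁ (sym (hangs-anchor {u} {v} h))) (sym pu≡pv))
  ... | inj₂ (inj₂ h) = λ pu≡pv → anchor-part v (trans (cong proj₁ (sym (hangs-anchor {v} {u} h))) pu≡pv)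

  spanning : IsSpanningSubgraph H
  spanning = H-sym , H-between-parts

  hangs-intro : ∀ {u v} → classify u ≡ nothing → v ≡ anchor u → T (hangs u v)
  hangs-intro {u} {v} leaf v≡anchor =
    Equivalence.from T-∧ (subst (T ∘ is-nothing) (sym leaf) tt , fromWitness {a? = v ≟ᵥ anchor u} v≡anchor)

  hangs⇒H : ∀ {u v} → T (hangs u v) → T (H u v)
  hangs⇒H {u} {v} h = Equivalence.from (T-∨ {joins (classify u) (classify v)})
    (inj₂ (Equivalence.from (T-∨ {hangs u v}) (inj₁ h)))

  leaf-edge : ∀ {u} → classify u ≡ nothing → T (H u (anchor u))
  leaf-edge {u} leaf = hangs⇒H {u} (hangs-intro {u} leaf refl)

  core-edge : ∀ {c d} → Adj c d → T (H (embed c) (embed d))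
  core-edge {c} {d} c≁d = Equivalence.from T-∨ (inj₁
    (subst₂ (λ x y → T (joins x y)) (sym (classify-embed c)) (sym (classify-embed d))
      (fromWitnessFalse {a? = part c Finₚ.≟ part d} c≁d)))

  leaf-neighbour : ∀ {u v} → classify u ≡ nothing → T (H u v) → v ≡ anchor u
  leaf-neighbour {u} {v} leaf t with H-cases {u} {v} t
  ... | inj₁ j          = ⊥-elim (subst (λ x → T (joins x (classify v))) leaf j)
  ... | inj₂ (inj₁ h)   = hangs-anchor {u} {v} h
  ... | inj₂ (inj₂ h)   = ⊥-elim (leaf-not-embedded leaf _ (hangs-anchor {v} {u} h))

  no-ℓ-cycle : ¬ HasCycle (suc N) (λ x y → T (H x y))
  no-ℓ-cycle = no-long-cycle (s≤s (≤-trans (s≤s z≤n) (m≤n+m (m + m) r′))) (λ {x} {y} → subst T (H-sym x y))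
                             label label-injective anchor (λ {w} {x} → pendant {w} {x})
    where
    label : W → Maybe (Fin N)
    label = Maybe.map (Inverse.from Fin↔Core) ∘ classify
    label-injective : ∀ {w w′ t} → label w ≡ just t → label w′ ≡ just t → w ≡ w′
    label-injective {w} {w′} e e′ with classify w in cw | classify w′ in cw′
    ... | just c | just d = trans (sym (embed-classify w cw)) (trans (cong embed c≡d) (embed-classify w′ cw′))
      where
      c≡d : c ≡ d
      c≡d = Injection.injective (↔⇒↣ (↔-sym Fin↔Core)) (trans (just-injective e) (sym (just-injective e′)))
    pendant : ∀ {w x} → label w ≡ nothing → T (H w x) → x ≡ anchor w
    pendant {w} {x} e = leaf-neighbour {w} {x} (unlabelled (classify w) e)
      where
      unlabelled : ∀ c? → Maybe.map (Inverse.from Fin↔Core) c? ≡ nothing → c? ≡ nothing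
      unlabelled nothing _ = refl

  module _ {u v : W} where

    HasCycle-AddEdge-swap : ∀ {L} → HasCycle L (AddEdge H u v) → HasCycle L (AddEdge H v u)
    HasCycle-AddEdge-swap (f , f-injective , f-adjacent) =
      f , f-injective , λ i j s → Sum.map₂ Sum.swap (f-adjacent i j s)

    embedPath : ∀ {a b L} → Path Adj a b L → Path (AddEdge H u v) (embed a) (embed b) L
    embedPath = mapPath embed embed-injective (inj₁ ∘ core-edge)

    leaf-core-cycle : ∀ {d} → classify u ≡ nothing → classify v ≡ just d → ¬ T (H u v) →
                      HasCycle (suc N) (AddEdge H u v)
    leaf-core-cycle {d} leaf core uv∉H =
      closePath (prepend u (embedPath P) (inj₁ (leaf-edge {u} leaf)) (All≢-map embed (leaf-not-embedded {u} leaf) _))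
                (inj₂ (inj₂ (embed-classify v core , refl)))
      where
      host≢d : host k≤N (proj₁ u) ≢ d
      host≢d host≡d =
        uv∉H (hangs⇒H {u} (hangs-intro {u} leaf (trans (sym (embed-classify v core)) (cong embed (sym host≡d)))))
      P : Path Adj (host k≤N (proj₁ u)) d N
      P = spanning-path p r′ r′≤1 (host k≤N (proj₁ u)) d host≢d

    leaf-leaf-cycle : classify u ≡ nothing → classify v ≡ nothing → KAdj u v → HasCycle (suc N) (AddEdge H u v)
    leaf-leaf-cycle leaf-u leaf-v pu≢pv =
      closePath (prepend v Q (inj₂ (inj₂ (refl , refl))) (v≢u ∷ All≢-map embed (leaf-not-embedded {v} leaf-v) _))
                (inj₁ (subst T (H-sym v (anchor v)) (leaf-edge {v} leaf-v)))
      where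
      hosts-differ : host k≤N (proj₁ u) ≢ host k≤N (proj₁ v)
      hosts-differ = pu≢pv ∘ host-injective k≤N
      P : Path Adj (host k≤N (proj₁ u)) (host k≤N (proj₁ v)) (r′ + (m + m))
      P = near-spanning-path p r′ r′≤1 (host k≤N (proj₁ u)) (host k≤N (proj₁ v)) hosts-differ
      Q : Path (AddEdge H u v) u (anchor v) N
      Q = prepend u (embedPath P) (inj₁ (leaf-edge {u} leaf-u)) (All≢-map embed (leaf-not-embedded {u} leaf-u) _)
      v≢u : v ≢ u
      v≢u v≡u = pu≢pv (cong proj₁ (sym v≡u))

  saturating : ∀ u v → KAdj u v → H u v ≡ false → HasCycle (suc N) (AddEdge H u v)
  saturating u v pu≢pv uv∉H = by-cases (classify u) refl (classify v) refl
    where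
    by-cases : ∀ x → classify u ≡ x → ∀ y → classify v ≡ y → HasCycle (suc N) (AddEdge H u v)
    by-cases nothing  cu (just _) cv = leaf-core-cycle cu cv (subst T uv∉H)
    by-cases (just _) cu nothing  cv =
      HasCycle-AddEdge-swap (leaf-core-cycle cv cu (subst T (trans (H-sym v u) uv∉H)))
    by-cases nothing  cu nothing  cv = leaf-leaf-cycle cu cv pu≢pv
    by-cases (just c) cu (just d) cv =
      ⊥-elim (subst T uv∉H (subst₂ (λ x y → T (H x y)) (embed-classify u cu) (embed-classify v cv) (core-edge c≁d)))
      where
      c≁d : Adj c d
      c≁d pc≡pd = pu≢pv (trans (cong proj₁ (sym (embed-classify u cu)))
                               (trans (cong (_↑ˡ k′) pc≡pd) (cong proj₁ (embed-classify v cv))))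

  saturated : IsCycleSaturated (suc N) H
  saturated = spanning , no-ℓ-cycle , saturating

  χ-core χ-leaf : W → ℕ
  χ-core u = χ (is-just (classify u))
  χ-leaf u = χ (is-nothing (classify u))

  part-count : ∀ q → ∑[ i ∈ allFin n ] χ-core (q , i) ≡ size q
  part-count q = trans (∑-cong (allFin n) (λ i → cong χ (is-just-map (place q) (shrink i (size q)))))
                       (count-shrink (size q) (size≤n q))

  ∑-by-part : ∀ (g : Fin k → ℕ) → ∑[ u ∈ AV ] (g (proj₁ u) * χ-core u) ≡ ∑[ q ∈ allFin k ] (g q * size q)
  ∑-by-part g = trans (∑-cartesianProduct (allFin k) (allFin n) (λ u → g (proj₁ u) * χ-core u))
    (∑-cong (allFin k) λ q →
      trans (∑-distribˡ-* (allFin n) (g q) (λ i → χ-core (q , i))) (cong (g q *_) (part-count q)))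

  ∑∑-by-part : ∀ (w : Fin k → Fin k → ℕ) →
    ∑[ u ∈ AV ] ∑[ v ∈ AV ] (w (proj₁ u) (proj₁ v) * (χ-core u * χ-core v))
      ≡ ∑[ p ∈ allFin k ] ∑[ q ∈ allFin k ] (w p q * (size p * size q))
  ∑∑-by-part w = begin
    ∑[ u ∈ AV ] ∑[ v ∈ AV ] (w (proj₁ u) (proj₁ v) * (χ-core u * χ-core v))
      ≡⟨ ∑-cong AV (λ u → ∑-cong AV (λ v → sym (*-assoc (w (proj₁ u) (proj₁ v)) (χ-core u) (χ-core v)))) ⟩
    ∑[ u ∈ AV ] ∑[ v ∈ AV ] (w (proj₁ u) (proj₁ v) * χ-core u * χ-core v)
      ≡⟨ ∑-cong AV (λ u → ∑-by-part (λ q → w (proj₁ u) q * χ-core u)) ⟩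
    ∑[ u ∈ AV ] ∑[ q ∈ allFin k ] (w (proj₁ u) q * χ-core u * size q)
      ≡⟨ ∑-cong AV (λ u → trans (∑-cong (allFin k) (λ q → swap-middle (w (proj₁ u) q) (χ-core u) (size q)))
                               (∑-distribʳ-* (allFin k) (χ-core u) (λ q → w (proj₁ u) q * size q))) ⟩
    ∑[ u ∈ AV ] (∑[ q ∈ allFin k ] (w (proj₁ u) q * size q) * χ-core u)
      ≡⟨ ∑-by-part (λ p → ∑[ q ∈ allFin k ] (w p q * size q)) ⟩
    ∑[ p ∈ allFin k ] (∑[ q ∈ allFin k ] (w p q * size q) * size p)
      ≡⟨ ∑-cong (allFin k) (λ p → trans (sym (∑-distribʳ-* (allFin k) (size p) (λ q → w p q * size q)))
                                       (∑-cong (allFin k) (λ q → swap-last (w p q) (size q) (size p)))) ⟩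
    ∑[ p ∈ allFin k ] ∑[ q ∈ allFin k ] (w p q * (size p * size q))
      ∎
    where
    open ≡-Reasoning
    swap-middle : ∀ a b c → a * b * c ≡ a * c * b
    swap-middle = solve-∀
    swap-last : ∀ a b c → a * b * c ≡ a * (c * b)
    swap-last = solve-∀

  joins-core : ∀ x y → χ (joins x y) ≤ χ (is-just x) * χ (is-just y)
  joins-core (just c) (just _) = χ≤1 (not ⌊ part c Finₚ.≟ _ ⌋)
  joins-core (just _) nothing  = z≤n
  joins-core nothing  _        = z≤n

  core-pair-bound : ∀ u v → χ (ltV u v ∧ joins (classify u) (classify v))
                            ≤ χ (toℕ (proj₁ u) <ᵇ toℕ (proj₁ v)) * (χ-core u * χ-core v)
  core-pair-bound u v =
    ≤-trans (χ-∧-≤ (joins (classify u) (classify v)) (λ t → ltV-cross (proj₂ u) (proj₂ v) (joins-parts {u} {v} t)))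
            (*-monoʳ-≤ (χ (toℕ (proj₁ u) <ᵇ toℕ (proj₁ v))) (joins-core (classify u) (classify v)))

  hang-count : ∀ u → ∑[ v ∈ AV ] χ (hangs u v) ≤ χ-leaf u
  hang-count u = begin
    ∑[ v ∈ AV ] χ (hangs u v)                 ≡⟨ ∑-cong (AV) (λ v → χ-∧ (is-nothing (classify u)) _) ⟩
    ∑[ v ∈ AV ] (χ-leaf u * χ ⌊ v ≟ᵥ anchor u ⌋) ≡⟨ ∑-distribˡ-* (AV) (χ-leaf u) _ ⟩
    χ-leaf u * ∑[ v ∈ AV ] χ ⌊ v ≟ᵥ anchor u ⌋   ≤⟨ *-monoʳ-≤ (χ-leaf u) (∑-delta _≟ᵥ_ allV-unique (anchor u)) ⟩
    χ-leaf u * 1                                    ≡⟨ *-identityʳ (χ-leaf u) ⟩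
    χ-leaf u                                        ∎
    where
    open ≤-Reasoning
    allV-unique : Unique AV
    allV-unique = Uniqueₚ.cartesianProduct⁺ (Uniqueₚ.allFin⁺ k) (Uniqueₚ.allFin⁺ n)

  numEdges≤ : numEdges H ≤ m * m + (m * r + m * r) + ∑[ u ∈ AV ] χ-leaf u
  numEdges≤ = begin
    numEdges H
      ≤⟨ ∑-mono AV (λ u → ∑-mono AV λ v →
           χ-∧-∨-∨ (ltV u v) (joins (classify u) (classify v)) (hangs u v) (hangs v u)) ⟩
    ∑[ u ∈ AV ] ∑[ v ∈ AV ] (χ (ltV u v ∧ joins (classify u) (classify v)) + hanging u v)
      ≡⟨ ∑-cong AV (λ u → ∑-distrib-+ AV _ (hanging u)) ⟩
    ∑[ u ∈ AV ] (∑[ v ∈ AV ] χ (ltV u v ∧ joins (classify u) (classify v)) + ∑ AV (hanging u))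
      ≡⟨ ∑-distrib-+ AV _ _ ⟩
    ∑[ u ∈ AV ] ∑[ v ∈ AV ] χ (ltV u v ∧ joins (classify u) (classify v)) + ∑[ u ∈ AV ] ∑ AV (hanging u)
      ≤⟨ +-mono-≤ (∑-mono AV (λ u → ∑-mono AV (core-pair-bound u)))
                  (≤-trans (∑∑-orient AV ltV ltV-asym (λ u v → χ (hangs u v))) (∑-mono AV hang-count)) ⟩
    ∑[ u ∈ AV ] ∑[ v ∈ AV ] (χ (toℕ (proj₁ u) <ᵇ toℕ (proj₁ v)) * (χ-core u * χ-core v)) + ∑ AV χ-leaf
      ≡⟨ cong (_+ ∑ AV χ-leaf)
              (trans (∑∑-by-part (λ p q → χ (toℕ p <ᵇ toℕ q))) (∑-ordered-pairs size (λ _ → refl))) ⟩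
    m * m + (m * r + m * r) + ∑ AV χ-leaf
      ∎
    where
    open ≤-Reasoning
    hanging : W → W → ℕ
    hanging u v = χ (ltV u v) * χ (hangs u v) + χ (ltV u v) * χ (hangs v u)

  leaf+core : ∀ u → χ-leaf u + χ-core u ≡ 1
  leaf+core u with classify u
  ... | just _  = refl
  ... | nothing = refl

  vertex-count : ∑[ u ∈ AV ] 1 ≡ k * n
  vertex-count = trans (∑-cartesianProduct (allFin k) (allFin n) (λ _ → 1))
    (trans (∑-cong (allFin k) (λ _ → trans (∑-allFin-const n 1) (*-identityʳ n))) (∑-allFin-const k n))

  core-count : ∑[ u ∈ AV ] χ-core u ≡ N
  core-count = trans (∑-cong (AV) (λ u → sym (*-identityˡ (χ-core u))))
    (trans (∑-by-part (λ _ → 1)) (trans (∑-first-three (λ q → 1 * size q) (λ _ → refl)) (reorder m r)))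
    where
    reorder : ∀ m r → 1 * m + (1 * m + 1 * r) ≡ r + (m + m)
    reorder = solve-∀

  numEdges+N≤ : numEdges H + N ≤ k * n + (m * m + (m * r + m * r))
  numEdges+N≤ = begin
    numEdges H + N                                    ≤⟨ +-monoˡ-≤ N numEdges≤ ⟩
    pairs + ∑ AV χ-leaf + N                           ≡⟨ cong (pairs + ∑ AV χ-leaf +_) (sym core-count) ⟩
    pairs + ∑ AV χ-leaf + ∑ AV χ-core                 ≡⟨ +-assoc pairs _ _ ⟩
    pairs + (∑ AV χ-leaf + ∑ AV χ-core)               ≡⟨ cong (pairs +_) (sym (∑-distrib-+ AV χ-leaf χ-core)) ⟩
    pairs + ∑[ u ∈ AV ] (χ-leaf u + χ-core u)         ≡⟨ cong (pairs +_) (trans (∑-cong AV leaf+core) vertex-count) ⟩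
    pairs + k * n                                     ≡⟨ +-comm pairs (k * n) ⟩
    k * n + pairs                                     ∎
    where
    open ≤-Reasoning
    pairs : ℕ
    pairs = m * m + (m * r + m * r)

halve : ∀ t → Σ ℕ λ h → Σ ℕ λ r′ → r′ ≤ 1 × t ≡ r′ + (h + h) × ⌊ t /2⌋ ≡ h
halve zero          = 0 , 0 , z≤n , refl , refl
halve (suc zero)    = 0 , 1 , s≤s z≤n , refl , refl
halve (suc (suc t)) with h , r′ , r′≤1 , t≡ , ⌊t/2⌋≡h ← halve t =
  suc h , r′ , r′≤1 , trans (cong (2 +_) t≡) (shift r′ h) , cong suc ⌊t/2⌋≡h
  where
  shift : ∀ r′ h → suc (suc (r′ + (h + h))) ≡ r′ + (suc h + suc h)
  shift = solve-∀

too-small : ∀ {r′ h} → r′ ≤ 1 → h ≤ 1 → ¬ 4 ≤ r′ + (h + h)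
too-small z≤n       z≤n       ()
too-small z≤n       (s≤s z≤n) (s≤s (s≤s ()))
too-small (s≤s z≤n) z≤n       (s≤s ())
too-small (s≤s z≤n) (s≤s z≤n) (s≤s (s≤s (s≤s ())))

cycle-length-split : ∀ ℓ → 6 ≤ ℓ → Σ ℕ λ p → Σ ℕ λ r′ →
  r′ ≤ 1 × ℓ ≡ suc (suc r′ + (suc (suc p) + suc (suc p))) × ⌊ ℓ ∸ 2 /2⌋ ≡ suc (suc p)
cycle-length-split (suc (suc t)) (s≤s (s≤s 4≤t)) with halve t
... | suc (suc p) , r′ , r′≤1 , t≡ , ⌊t/2⌋≡m = p , r′ , r′≤1 , cong (2 +_) t≡ , ⌊t/2⌋≡m
... | zero        , r′ , r′≤1 , t≡ , _       = ⊥-elim (too-small r′≤1 z≤n (subst (4 ≤_) t≡ 4≤t))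
... | suc zero    , r′ , r′≤1 , t≡ , _       = ⊥-elim (too-small r′≤1 (s≤s z≤n) (subst (4 ≤_) t≡ 4≤t))

bound-rewrite : ∀ {E} kn m r → E + (r + (m + m)) ≤ kn + (m * m + (m * r + m * r)) →
                E + suc (r + (m + m)) ≤ kn + 1 + m * m + 2 * (suc (r + (m + m)) ∸ 1 ∸ 2 * m) * m
bound-rewrite {E} kn m r E+N≤ = begin
  E + suc (r + (m + m))                          ≡⟨ +-suc E _ ⟩
  suc (E + (r + (m + m)))                        ≤⟨ s≤s E+N≤ ⟩
  suc (kn + (m * m + (m * r + m * r)))           ≡⟨ reorder kn m r ⟩
  kn + 1 + m * m + 2 * r * m                     ≡⟨ cong (λ x → kn + 1 + m * m + 2 * x * m) (sym r≡) ⟩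
  kn + 1 + m * m + 2 * (r + (m + m) ∸ 2 * m) * m ∎
  where
  open ≤-Reasoning
  reorder : ∀ kn m r → suc (kn + (m * m + (m * r + m * r))) ≡ kn + 1 + m * m + 2 * r * m
  reorder = solve-∀
  r≡ : r + (m + m) ∸ 2 * m ≡ r
  r≡ = trans (cong (r + (m + m) ∸_) (cong (m +_) (+-identityʳ m))) (m+n∸n≡m r (m + m))

theorem1p3 : (k ℓ n : ℕ) → 3 ≤ k → k < ℓ → 6 ≤ ℓ → ⌊ ℓ ∸ 2 /2⌋ ≤ n →
    Σ (Graph k n) λ H → IsCycleSaturated ℓ H ×
      (numEdges H + ℓ ≤ k * n + 1 + ⌊ ℓ ∸ 2 /2⌋ * ⌊ ℓ ∸ 2 /2⌋
         + 2 * (ℓ ∸ 1 ∸ 2 * ⌊ ℓ ∸ 2 /2⌋) * ⌊ ℓ ∸ 2 /2⌋)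
theorem1p3 (suc (suc (suc k′))) ℓ n (s≤s (s≤s (s≤s _))) k<ℓ 6≤ℓ ⌊ℓ-2/2⌋≤n
  with p , r′ , r′≤1 , refl , ⌊ℓ-2/2⌋≡m ← cycle-length-split ℓ 6≤ℓ
  rewrite ⌊ℓ-2/2⌋≡m =
  H , saturated , bound-rewrite (k * n) m r numEdges+N≤
  where
  open Construction k′ n p r′ r′≤1 ⌊ℓ-2/2⌋≤n (≤-pred k<ℓ)
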